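{- For each $1\le k<\omega$, let $\vdash_k \;:=\; \vdash_{\mathcal{H}^{2k-1}}$. Then $\vdash_1\subseteq\vdash_2\subseteq\cdots$, and $\vdash_{\mathbf{mCi}} = \bigsqcup_{1\le k<\omega}\vdash_k$.
   Context: Let $\Sigma$ be the propositional signature with unary connectives $\neg,\circ$ and binary connectives $\land,\lor,\to$, and let $L$ be the set of $\Sigma$-formulas over a denumerable set $P$ of propositional variables. A (schematic) Set-Fmla Hilbert-style system is a collection of rule schemas $\Gamma/\varphi$ (with finite $\Gamma$; axioms have $\Gamma=\varnothing$), each rule consisting of all substitution instances of its schema; $\Gamma \vdash_{\mathcal{H}} \varphi$ holds iff there is a finite sequence of formulas ending in $\varphi$ each of which belongs to $\Gamma$ or is the conclusion of a rule instance whose premises occur earlier. Fix a Set-Fmla H-system for positive classical logic (the $\{\land,\lor,\to\}$-fragment of classical logic). For $j\in\omega$, $\neg^j$ denotes $j$-fold application of $\neg$. Consider the axiom schemas (Ax10) $p\lor\neg p$; (bc1) $\circ p\to(p\to(\neg p\to q))$; (ci) $\neg\circ p\to(p\land\neg p)$; and (cc)$_j$ $\circ\neg^j\circ p$ for $j\in\omega$. For $k\in\omega$, $\mathcal{H}^k$ is the positive classical system extended with (Ax10), (bc1), (ci) and (cc)$_j$ for all $0\le j\le k$. The logic $\mathbf{mCi}$ is the consequence relation $\vdash_{\mathbf{mCi}}$ of the system extending the positive classical system with (Ax10), (bc1), (ci) and (cc)$_j$ for all $j\in\omega$. A Tarskian consequence relation on $L$ is a relation $\vdash\subseteq \mathcal{P}(L)\times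 L$ satisfying reflexivity ($\varphi\in\Gamma$ implies $\Gamma\vdash\varphi$), monotonicity and transitivity (cut); it is standard if it is moreover substitution-invariant and finitary. The Tarskian consequence relations on $L$ form a complete lattice under inclusion, and $\bigsqcup C$ denotes the supremum of a set $C$ of them in this lattice (the least Tarskian consequence relation containing all members of $C$). -}

module Defs where

open import Data.Nat using (ℕ; zero; suc; _*_; _∸_; _≤_)
open import Data.List using (List; []; _∷_)
open import Data.List.Relation.Unary.All using (All)
open import Data.List.Membership.Propositional using (_∈_)
open import Data.Product using (_×_)
open import Relation.Binary.PropositionalEquality using (_≡_)
open import Level using (Level; _⊔_) renaming (suc to lsuc; zero to lzero)

infixr 5 _⇒_
infixr 6 _∨_
infixr 7 _∧_

data Fmla : Set where
  var : ℕ → Fmla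
  ¬_  : Fmla → Fmla
  ∘_  : Fmla → Fmla
  _∧_ : Fmla → Fmla → Fmla
  _∨_ : Fmla → Fmla → Fmla
  _⇒_ : Fmla → Fmla → Fmla

Subst : Set
Subst = ℕ → Fmla

_[_] : Fmla → Subst → Fmla
var n   [ σ ] = σ n
(¬ φ)   [ σ ] = ¬ (φ [ σ ])
(∘ φ)   [ σ ] = ∘ (φ [ σ ])
(φ ∧ ψ) [ σ ] = (φ [ σ ]) ∧ (ψ [ σ ])
(φ ∨ ψ) [ σ ] = (φ [ σ ]) ∨ (ψ [ σ ])
(φ ⇒ ψ) [ σ ] = (φ [ σ ]) ⇒ (ψ [ σ ])

¬^ : ℕ → Fmla → Fmla
¬^ zero    φ = φ
¬^ (suc j) φ = ¬ (¬^ j φ)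

FSet : Set₁
FSet = Fmla → Set

-- A (proof-relevant) relation ⊆ P(L) × L
CRel : (ℓ : Level) → Set (lsuc lzero ⊔ lsuc ℓ)
CRel ℓ = FSet → Fmla → Set ℓ

_⊆ᶠ_ : FSet → FSet → Set
Γ ⊆ᶠ Δ = ∀ φ → Γ φ → Δ φ

_⊑_ : ∀ {a b} → CRel a → CRel b → Set (lsuc lzero ⊔ a ⊔ b)
R ⊑ S = ∀ Γ φ → R Γ φ → S Γ φ

record Tarskian {ℓ} (R : CRel ℓ) : Set (lsuc lzero ⊔ ℓ) where
  field
    reflexivity  : ∀ Γ φ → Γ φ → R Γ φ
    monotonicity : ∀ Γ Δ φ → Γ ⊆ᶠ Δ → R Γ φ → R Δ φ
    transitivity : ∀ Γ Δ φ → (∀ ψ → Δ ψ → R Γ ψ) → R Δ φ → R Γ φ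

-- Supremum of a family {R i | i ∈ I, P i} in the complete lattice of
-- Tarskian consequence relations: the least Tarskian relation containing
-- all members, i.e. the intersection of all Tarskian upper bounds.
⨆ : ∀ {ℓ} {I : Set} (P : I → Set) (R : I → CRel ℓ) → CRel (lsuc lzero ⊔ lsuc ℓ)
⨆ {ℓ} {I} P R Γ φ =
  (S : CRel ℓ) → Tarskian S → (∀ i → P i → R i ⊑ S) → S Γ φ

record Rule : Set where
  constructor _/_
  field
    premises   : List Fmla
    conclusion : Fmla

HSystem : Set₁
HSystem = Rule → Set

data _⊢[_]_ (Γ : FSet) (H : HSystem) : Fmla → Set where
  hyp  : ∀ {φ} → Γ φ → Γ ⊢[ H ] φ
  rule : ∀ {ps c} → H (ps / c) → (σ : Subst) →
         (∀ {ψ} → ψ ∈ ps → Γ ⊢[ H ] (ψ [ σ ])) →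
         Γ ⊢[ H ] (c [ σ ])

p q r : Fmla
p = var 0
q = var 1
r = var 2

data PosCL : HSystem where
  Ax1 : PosCL ([] / (p ⇒ (q ⇒ p)))
  Ax2 : PosCL ([] / ((p ⇒ q) ⇒ ((p ⇒ (q ⇒ r)) ⇒ (p ⇒ r))))
  Ax3 : PosCL ([] / (p ⇒ (q ⇒ (p ∧ q))))
  Ax4 : PosCL ([] / ((p ∧ q) ⇒ p))
  Ax5 : PosCL ([] / ((p ∧ q) ⇒ q))
  Ax6 : PosCL ([] / (p ⇒ (p ∨ q)))
  Ax7 : PosCL ([] / (q ⇒ (p ∨ q)))
  Ax8 : PosCL ([] / ((p ⇒ r) ⇒ ((q ⇒ r) ⇒ ((p ∨ q) ⇒ r))))
  Ax9 : PosCL ([] / (p ∨ (p ⇒ q)))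
  MP  : PosCL ((p ∷ (p ⇒ q) ∷ []) / q)

data H^ (k : ℕ) : HSystem where
  pos  : ∀ {ρ} → PosCL ρ → H^ k ρ
  Ax10 : H^ k ([] / (p ∨ ¬ p))
  bc1  : H^ k ([] / (∘ p ⇒ (p ⇒ (¬ p ⇒ q))))
  ci   : H^ k ([] / (¬ (∘ p) ⇒ (p ∧ ¬ p)))
  cc   : ∀ j → j ≤ k → H^ k ([] / (∘ (¬^ j (∘ p))))

data HmCi : HSystem where
  pos  : ∀ {ρ} → PosCL ρ → HmCi ρ
  Ax10 : HmCi ([] / (p ∨ ¬ p))
  bc1  : HmCi ([] / (∘ p ⇒ (p ⇒ (¬ p ⇒ q))))
  ci   : HmCi ([] / (¬ (∘ p) ⇒ (p ∧ ¬ p)))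
  cc   : ∀ j → HmCi ([] / (∘ (¬^ j (∘ p))))

_⊢mCi_ : CRel lzero
Γ ⊢mCi φ = Γ ⊢[ HmCi ] φ

⊢ₖ : ℕ → CRel lzero
⊢ₖ k Γ φ = Γ ⊢[ H^ (2 * k ∸ 1) ] φ

-- Every mCi-derivation is finite and so uses only finitely many instances of the
-- schemas (cc)_j; hence it is already a derivation in some H^n, and H^n is contained in
-- H^(2k-1) for k = n + 1. Conversely every H^n is a subsystem of mCi, and derivability in a
-- fixed H-system is Tarskian, so mCi is a Tarskian upper bound of the ⊢_k.
module Submission where

open import Defs
open import Data.Nat using (ℕ; suc; _≤_; _⊔_; z≤n; s≤s)
open import Data.Nat.Properties using (≤-trans; ≤-refl; m≤m⊔n; m≤n⊔m; m≤m+n; n≤1+n; *-monoʳ-≤; ∸-monoˡ-≤)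
open import Data.Product using (_×_; _,_; ∃-syntax)
open import Data.List using (List; []; _∷_)
open import Data.List.Relation.Unary.Any using (here; there)
open import Data.List.Membership.Propositional using (_∈_)
open import Function.Bundles using (_⇔_; mk⇔)
open import Level using (Level)
open import Relation.Binary.PropositionalEquality using (refl)

private
  variable
    ℓ : Level
    H H′ : HSystem
    Γ Δ : FSet
    φ : Fmla

⊢-map-system : (∀ {ρ} → H ρ → H′ ρ) → Γ ⊢[ H ] φ → Γ ⊢[ H′ ] φ
⊢-map-system f (hyp γ)      = hyp γ
⊢-map-system f (rule r σ d) = rule (f r) σ (λ m → ⊢-map-system f (d m))

⊢-monoˡ : Γ ⊆ᶠ Δ → Γ ⊢[ H ] φ → Δ ⊢[ H ] φ
⊢-monoˡ Γ⊆Δ (hyp γ)      = hyp (Γ⊆Δ _ γ)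
⊢-monoˡ Γ⊆Δ (rule r σ d) = rule r σ (λ m → ⊢-monoˡ Γ⊆Δ (d m))

⊢-cut : (∀ ψ → Δ ψ → Γ ⊢[ H ] ψ) → Δ ⊢[ H ] φ → Γ ⊢[ H ] φ
⊢-cut Γ⊢Δ (hyp δ)      = Γ⊢Δ _ δ
⊢-cut Γ⊢Δ (rule r σ d) = rule r σ (λ m → ⊢-cut Γ⊢Δ (d m))

⊢-tarskian : (H : HSystem) → Tarskian (_⊢[ H ]_)
⊢-tarskian H = record
  { reflexivity  = λ _ _ → hyp
  ; monotonicity = λ _ _ _ → ⊢-monoˡ
  ; transitivity = λ _ _ _ → ⊢-cut
  }

⨆-upper : {I : Set} (P : I → Set) (R : I → CRel ℓ) → ∀ i → P i → R i ⊑ ⨆ P R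
⨆-upper P R i Pi Γ φ Rφ S _ R⊑S = R⊑S i Pi Γ φ Rφ

⨆-least : {I : Set} (P : I → Set) (R : I → CRel ℓ) (S : CRel ℓ) →
          Tarskian S → (∀ i → P i → R i ⊑ S) → ⨆ P R ⊑ S
⨆-least P R S S-tarskian R⊑S Γ φ ⨆φ = ⨆φ S S-tarskian R⊑S

bound-∈ : (P : ℕ → Fmla → Set) → (∀ {m n ψ} → m ≤ n → P m ψ → P n ψ) →
          (ps : List Fmla) → (∀ {ψ} → ψ ∈ ps → ∃[ n ] P n ψ) →
          ∃[ n ] (∀ {ψ} → ψ ∈ ps → P n ψ)
bound-∈ P mono []       _  = 0 , λ ()
bound-∈ P mono (ψ ∷ ps) bd with bd (here refl) | bound-∈ P mono ps (λ m → bd (there m))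
... | m , Pmψ | n , Pn = m ⊔ n , λ where
  (here refl) → mono (m≤m⊔n m n) Pmψ
  (there ψ∈ps)    → mono (m≤n⊔m m n) (Pn ψ∈ps)

module Compactness
  (H : ℕ → HSystem) (H-mono : ∀ {m n ρ} → m ≤ n → H m ρ → H n ρ)
  (H∞ : HSystem) (H∞⇒H : ∀ {ρ} → H∞ ρ → ∃[ n ] H n ρ)
  where

  ⊢H-mono : ∀ {m n} → m ≤ n → Γ ⊢[ H m ] φ → Γ ⊢[ H n ] φ
  ⊢H-mono m≤n = ⊢-map-system (H-mono m≤n)

  ⊢-compact : Γ ⊢[ H∞ ] φ → ∃[ n ] Γ ⊢[ H n ] φ
  ⊢-compact (hyp γ) = 0 , hyp γ
  ⊢-compact {Γ} (rule {ps} r σ d)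
    with H∞⇒H r | bound-∈ (λ n ψ → Γ ⊢[ H n ] (ψ [ σ ])) ⊢H-mono ps (λ m → ⊢-compact (d m))
  ... | m , rₘ | n , dₙ =
    m ⊔ n , rule (H-mono (m≤m⊔n m n) rₘ) σ (λ ψ∈ps → ⊢H-mono (m≤n⊔m m n) (dₙ ψ∈ps))

H^-mono : ∀ {m n ρ} → m ≤ n → H^ m ρ → H^ n ρ
H^-mono m≤n (pos r)    = pos r
H^-mono m≤n Ax10       = Ax10
H^-mono m≤n bc1        = bc1
H^-mono m≤n ci         = ci
H^-mono m≤n (cc j j≤m) = cc j (≤-trans j≤m m≤n)

H^⇒HmCi : ∀ {n ρ} → H^ n ρ → HmCi ρ
H^⇒HmCi (pos r)  = pos r
H^⇒HmCi Ax10     = Ax10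
H^⇒HmCi bc1      = bc1
H^⇒HmCi ci       = ci
H^⇒HmCi (cc j _) = cc j

HmCi⇒H^ : ∀ {ρ} → HmCi ρ → ∃[ n ] H^ n ρ
HmCi⇒H^ (pos r) = 0 , pos r
HmCi⇒H^ Ax10    = 0 , Ax10
HmCi⇒H^ bc1     = 0 , bc1
HmCi⇒H^ ci      = 0 , ci
HmCi⇒H^ (cc j)  = j , cc j ≤-refl

open Compactness H^ H^-mono HmCi HmCi⇒H^ using () renaming (⊢-compact to ⊢mCi⇒⊢H^)

⊢ₖ-mono : ∀ {k l} → k ≤ l → ⊢ₖ k ⊑ ⊢ₖ l
⊢ₖ-mono k≤l _ _ = ⊢-map-system (H^-mono (∸-monoˡ-≤ 1 (*-monoʳ-≤ 2 k≤l)))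

-- 2 * suc n ∸ 1 reduces to n + suc (n + 0).
⊢H^⇒⊢ₖ : ∀ {n} → Γ ⊢[ H^ n ] φ → ⊢ₖ (suc n) Γ φ
⊢H^⇒⊢ₖ {n = n} = ⊢-map-system (H^-mono (m≤m+n n _))

lemma1 : ((k : ℕ) → 1 ≤ k → ⊢ₖ k ⊑ ⊢ₖ (suc k))
         × ((Γ : FSet) (φ : Fmla) → (Γ ⊢mCi φ) ⇔ ⨆ (λ k → 1 ≤ k) ⊢ₖ Γ φ)
lemma1 = (λ k _ → ⊢ₖ-mono (n≤1+n k))
       , λ Γ φ → mk⇔ (mCi⊑⨆ Γ φ) (⨆⊑mCi Γ φ)
  where
  mCi⊑⨆ : _⊢mCi_ ⊑ ⨆ (λ k → 1 ≤ k) ⊢ₖ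
  mCi⊑⨆ Γ φ d with ⊢mCi⇒⊢H^ d
  ... | n , dₙ = ⨆-upper (λ k → 1 ≤ k) ⊢ₖ (suc n) (s≤s z≤n) Γ φ (⊢H^⇒⊢ₖ dₙ)

  ⨆⊑mCi : ⨆ (λ k → 1 ≤ k) ⊢ₖ ⊑ _⊢mCi_
  ⨆⊑mCi = ⨆-least (λ k → 1 ≤ k) ⊢ₖ _⊢mCi_ (⊢-tarskian HmCi)
                   (λ k _ _ _ → ⊢-map-system H^⇒HmCi)
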